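{- For any weak composition $\mathbf{a}=(a_1,\dots,a_n)$, the Kohnert poset $\mathcal{P}(\mathbb{D}(\mathbf{a}))$ is bounded.
   Context: A diagram is a finite set $D$ of cells $(r,c)$ with $r,c$ positive integers; $r$ is the row (rows numbered from bottom to top starting at 1) and $c$ the column (numbered from left to right starting at 1). A Kohnert move at row $r$ applied to a diagram $D$: if row $r$ of $D$ is empty, $D$ is unchanged; otherwise let $(r,c)$ be the cell of row $r$ with the largest column index; if every position $(r',c)$ with $1\le r'<r$ belongs to $D$, then $D$ is unchanged; otherwise let $r'$ be the largest integer with $1\le r'<r$ and $(r',c)\notin D$, and the move replaces the cell $(r,c)$ by $(r',c)$. For a diagram $D_0$, $KD(D_0)$ is the set of all diagrams obtainable from $D_0$ by finite (possibly empty) sequences of Kohnert moves; the Kohnert poset $\mathcal{P}(D_0)$ is $KD(D_0)$ ordered by $D_2\preceq D_1$ iff $D_2$ can be obtained from $D_1$ by a finite sequence of Kohnert moves. A finite poset is bounded if it has a unique minimal element and a unique maximal element. For a weak composition $\mathbf{a}=(a_1,\dots,a_n)\in\mathbb{Z}_{\ge0}^n$, the key diagram is $\mathbb{D}(\mathbf{a})=\bigcup_{i=1}^n\{(i,j):1\le j\le a_i\}$. -}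

module Defs where

open import Data.Nat using (ℕ; zero; suc; _∸_; _≡ᵇ_; _⊔_)
open import Data.Bool using (Bool; true; false; if_then_else_; not; _∧_)
open import Data.Maybe using (Maybe; just; nothing)
open import Data.Product using (_×_; _,_; Σ; ∃)
open import Data.List using (List; []; _∷_; filter; any; _++_; concat; map; upTo)
open import Data.List.Membership.Propositional using (_∈_)
open import Relation.Nullary using (¬_)

-- A cell (r , c): r = row (bottom to top, from 1), c = column (from 1).
Cell : Set
Cell = ℕ × ℕ

-- A diagram is a finite set of cells, represented by a list (order and
-- repetitions irrelevant); diagrams are compared as sets via _≈D_.
Diagram : Set
Diagram = List Cell

_≈D_ : Diagram → Diagram → Set
D ≈D E = ∀ x → (x ∈ D → x ∈ E) × (x ∈ E → x ∈ D)

cellEq : Cell → Cell → Bool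
cellEq (r , c) (r' , c') = (r ≡ᵇ r') ∧ (c ≡ᵇ c')

memb : Cell → Diagram → Bool
memb x [] = false
memb x (y ∷ D) = if cellEq x y then true else memb x D

maxM : ℕ → Maybe ℕ → ℕ
maxM c nothing = c
maxM c (just d) = c ⊔ d

rowMax : ℕ → Diagram → Maybe ℕ
rowMax r [] = nothing
rowMax r ((r₀ , c₀) ∷ D) =
  if r₀ ≡ᵇ r then just (maxM c₀ (rowMax r D)) else rowMax r D

findGap : ℕ → Diagram → ℕ → Maybe ℕ
findGap c D zero = nothing
findGap c D (suc k) = if memb (suc k , c) D then findGap c D k else just (suc k)

removeCell : Cell → Diagram → Diagram
removeCell x [] = []
removeCell x (y ∷ D) = if cellEq x y then removeCell x D else y ∷ removeCell x D

moveAt : ℕ → ℕ → Diagram → Maybe ℕ → Diagram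
moveAt r c D nothing = D
moveAt r c D (just r') = (r' , c) ∷ removeCell (r , c) D

moveCol : ℕ → Diagram → Maybe ℕ → Diagram
moveCol r D nothing = D
moveCol r D (just c) = moveAt r c D (findGap c D (r ∸ 1))

kohnertMove : ℕ → Diagram → Diagram
kohnertMove r D = moveCol r D (rowMax r D)

data Reach : Diagram → Diagram → Set where
  done : ∀ {D} → Reach D D
  step : ∀ {D E} (r : ℕ) → Reach (kohnertMove r D) E → Reach D E

-- Kohnert poset P(D₀): carrier KD(D₀) = {D | Reach D₀ D},
-- order  D₂ ⪯ D₁  iff  Reach D₁ D₂ ; elements equal iff equal as sets.
_⪯_ : Diagram → Diagram → Set
D₂ ⪯ D₁ = Reach D₁ D₂

InKD : Diagram → Diagram → Set
InKD D₀ D = Reach D₀ D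

IsMinimal : Diagram → Diagram → Set
IsMinimal D₀ m = InKD D₀ m × (∀ x → InKD D₀ x → x ⪯ m → x ≈D m)

IsMaximal : Diagram → Diagram → Set
IsMaximal D₀ m = InKD D₀ m × (∀ x → InKD D₀ x → m ⪯ x → x ≈D m)

Bounded : Diagram → Set
Bounded D₀ =
  (Σ Diagram λ m → IsMinimal D₀ m × (∀ m' → IsMinimal D₀ m' → m' ≈D m))
  × (Σ Diagram λ M → IsMaximal D₀ M × (∀ M' → IsMaximal D₀ M' → M' ≈D M))

keyRows : ℕ → List ℕ → Diagram
keyRows i [] = []
keyRows i (aᵢ ∷ a) = map (λ j → (i , suc j)) (upTo aᵢ) ++ keyRows (suc i) a

keyDiagram : List ℕ → Diagram
keyDiagram a = keyRows 1 a

-- The key diagram is the maximum: a Kohnert move lowers one cell and so strictly decreases the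
-- sum of the row indices, hence a diagram reachable from D(a) that reaches D(a) back equals it.
-- For the minimum, call a diagram dominated if for all columns 1 ≤ c < c' and every row s,
-- column c has at least as many cells in rows ≥ s as column c'. Key diagrams are dominated since
-- their rows are left-justified, and Kohnert moves preserve dominance and the column sizes.
-- A minimal element admits no move, so the last cell of each row has no gap below it; with
-- dominance this forces every column to fill exactly the rows 1, …, (its size in D(a)).
-- Hence all minimal elements coincide, and one exists because moves decrease the row sum.

module Submission where

open import Defs
open import Data.Nat using (ℕ; zero; suc; _+_; _∸_; _≤_; _<_; _≡ᵇ_; z≤n; s≤s; s≤s⁻¹)
open import Data.Nat.Properties
open import Data.Bool using (Bool; true; false)
open import Data.Maybe using (just; nothing)
open import Data.Product using (_×_; _,_; Σ; ∃; proj₁; proj₂)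
open import Data.Sum using (_⊎_; inj₁; inj₂)
open import Data.List using (List; []; _∷_; map; upTo; length)
open import Data.List.Membership.Propositional using (_∈_; _∉_)
open import Data.List.Membership.Propositional.Properties using (∈-++⁻; ∈-map⁻; ∈-upTo⁻; ∈-++⁺ˡ; ∈-++⁺ʳ; ∈-map⁺; ∈-upTo⁺)
open import Data.List.Relation.Unary.Any using (here; there)
open import Relation.Binary.PropositionalEquality
open import Algebra.Properties.CommutativeSemigroup +-commutativeSemigroup using (x∙yz≈y∙xz)
open import Function using (case_of_; _∘_)
open import Relation.Nullary using (¬_; Dec; yes; no; contradiction)

≡ᵇ-true⇒≡ : ∀ {m n} → (m ≡ᵇ n) ≡ true → m ≡ n
≡ᵇ-true⇒≡ {zero} {zero} _ = refl
≡ᵇ-true⇒≡ {suc m} {suc n} e = cong suc (≡ᵇ-true⇒≡ e)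

≡ᵇ-refl : ∀ n → (n ≡ᵇ n) ≡ true
≡ᵇ-refl zero = refl
≡ᵇ-refl (suc n) = ≡ᵇ-refl n

cellEq⇒≡ : ∀ x y → cellEq x y ≡ true → x ≡ y
cellEq⇒≡ (r , c) (r' , c') e with r ≡ᵇ r' in er | c ≡ᵇ c' in ec
... | true | true = cong₂ _,_ (≡ᵇ-true⇒≡ er) (≡ᵇ-true⇒≡ ec)

cellEq-refl : ∀ x → cellEq x x ≡ true
cellEq-refl (r , c) rewrite ≡ᵇ-refl r | ≡ᵇ-refl c = refl

cellEq-false⇒≢ : ∀ x y → cellEq x y ≡ false → x ≢ y
cellEq-false⇒≢ x .x e refl with () ← trans (sym e) (cellEq-refl x)

memb⇒∈ : ∀ {x} D → memb x D ≡ true → x ∈ D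
memb⇒∈ {x} (y ∷ D) e with cellEq x y in eq
... | true = here (cellEq⇒≡ x y eq)
... | false = there (memb⇒∈ D e)

∈⇒memb : ∀ {x} D → x ∈ D → memb x D ≡ true
∈⇒memb {x} (y ∷ D) (here refl) rewrite cellEq-refl x = refl
∈⇒memb {x} (y ∷ D) (there x∈D) with cellEq x y
... | true = refl
... | false = ∈⇒memb D x∈D

∉⇒memb : ∀ {x} D → x ∉ D → memb x D ≡ false
∉⇒memb {x} D x∉D with memb x D in e
... | false = refl
... | true = contradiction (memb⇒∈ D e) x∉D

memb⇒∉ : ∀ {x} D → memb x D ≡ false → x ∉ D
memb⇒∉ D e x∈D with () ← trans (sym e) (∈⇒memb D x∈D)

memb-cong : ∀ {x} D E → (x ∈ D → x ∈ E) → (x ∈ E → x ∈ D) → memb x D ≡ memb x E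
memb-cong {x} D E D⊆E E⊆D with memb x D in eD | memb x E in eE
... | true | true = refl
... | false | false = refl
... | true | false = contradiction (D⊆E (memb⇒∈ D eD)) (memb⇒∉ E eE)
... | false | true = contradiction (E⊆D (memb⇒∈ E eE)) (memb⇒∉ D eD)

∈-removeCell⁻ : ∀ {x y} D → x ∈ removeCell y D → x ∈ D × x ≢ y
∈-removeCell⁻ {x} {y} (z ∷ D) x∈ with cellEq y z in eq | x∈
... | true | x∈′ = let (x∈D , x≢y) = ∈-removeCell⁻ D x∈′ in there x∈D , x≢y
... | false | here refl = here refl , λ x≡y → cellEq-false⇒≢ y x eq (sym x≡y)
... | false | there x∈′ = let (x∈D , x≢y) = ∈-removeCell⁻ D x∈′ in there x∈D , x≢y

∈-removeCell⁺ : ∀ {x y} D → x ∈ D → x ≢ y → x ∈ removeCell y D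
∈-removeCell⁺ {x} {y} (z ∷ D) (here refl) x≢y with cellEq y x in eq
... | true = contradiction (sym (cellEq⇒≡ y x eq)) x≢y
... | false = here refl
∈-removeCell⁺ {x} {y} (z ∷ D) (there x∈D) x≢y with cellEq y z
... | true = ∈-removeCell⁺ D x∈D x≢y
... | false = there (∈-removeCell⁺ D x∈D x≢y)

rowMax-∈ : ∀ r D {c} → rowMax r D ≡ just c → (r , c) ∈ D
rowMax-∈ r ((r₀ , c₀) ∷ D) e with r₀ ≡ᵇ r in same
... | false = there (rowMax-∈ r D e)
... | true with ≡ᵇ-true⇒≡ {r₀} {r} same | rowMax r D in rest | e
...   | refl | nothing | refl = here refl
...   | refl | just d | refl with ⊔-sel c₀ d
...     | inj₁ c₀⊔d≡c₀ rewrite c₀⊔d≡c₀ = here refl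
...     | inj₂ c₀⊔d≡d rewrite c₀⊔d≡d = there (rowMax-∈ r D rest)

∈⇒rowMax-just : ∀ r D {c} → (r , c) ∈ D → ∃ λ d → rowMax r D ≡ just d
∈⇒rowMax-just r ((r₀ , c₀) ∷ D) (here refl) rewrite ≡ᵇ-refl r = _ , refl
∈⇒rowMax-just r ((r₀ , c₀) ∷ D) (there x∈D) with r₀ ≡ᵇ r
... | true = _ , refl
... | false = ∈⇒rowMax-just r D x∈D

rowMax-maximal : ∀ r D {c c'} → rowMax r D ≡ just c → (r , c') ∈ D → c' ≤ c
rowMax-maximal r ((r₀ , c₀) ∷ D) e (here refl) rewrite ≡ᵇ-refl r with rowMax r D | e
... | nothing | refl = ≤-refl
... | just d | refl = m≤m⊔n c₀ d
rowMax-maximal r ((r₀ , c₀) ∷ D) e (there x∈D) with r₀ ≡ᵇ r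
... | false = rowMax-maximal r D e x∈D
... | true with rowMax r D in rest | e
...   | just d | refl = ≤-trans (rowMax-maximal r D rest x∈D) (m≤n⊔m c₀ d)
...   | nothing | refl with () ← trans (sym rest) (proj₂ (∈⇒rowMax-just r D x∈D))

findGap-nothing : ∀ c D k → findGap c D k ≡ nothing → ∀ z → 1 ≤ z → z ≤ k → memb (z , c) D ≡ true
findGap-nothing c D zero e z (s≤s _) ()
findGap-nothing c D (suc k) e z 1≤z z≤1+k with memb (suc k , c) D in full | m≤n⇒m<n∨m≡n z≤1+k
... | true | inj₁ z<1+k = findGap-nothing c D k e z 1≤z (s≤s⁻¹ z<1+k)
... | true | inj₂ refl = full

findGap-bounds : ∀ c D k {r'} → findGap c D k ≡ just r' → 1 ≤ r' × r' ≤ k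
findGap-bounds c D (suc k) e with memb (suc k , c) D | e
... | true | e′ = let (1≤r' , r'≤k) = findGap-bounds c D k e′ in 1≤r' , m≤n⇒m≤1+n r'≤k
... | false | refl = s≤s z≤n , ≤-refl

findGap-free : ∀ c D k {r'} → findGap c D k ≡ just r' → memb (r' , c) D ≡ false
findGap-free c D (suc k) e with memb (suc k , c) D in free | e
... | true | e′ = findGap-free c D k e′
... | false | refl = free

findGap-above : ∀ c D k {r'} → findGap c D k ≡ just r' → ∀ z → r' < z → z ≤ k → memb (z , c) D ≡ true
findGap-above c D (suc k) e z r'<z z≤1+k with memb (suc k , c) D in full | e
... | false | refl = contradiction z≤1+k (<⇒≱ r'<z)
... | true | e′ with m≤n⇒m<n∨m≡n z≤1+k
...   | inj₁ z<1+k = findGap-above c D k e′ z r'<z (s≤s⁻¹ z<1+k)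
...   | inj₂ refl = full

record Fires (r : ℕ) (D : Diagram) : Set where
  constructor fires
  field
    col gap : ℕ
    rowMax≡col : rowMax r D ≡ just col
    findGap≡gap : findGap col D (r ∸ 1) ≡ just gap

fires? : ∀ r D → Dec (Fires r D)
fires? r D with rowMax r D in e₁
... | nothing = no λ where (fires _ _ e₁′ _) → case trans (sym e₁) e₁′ of λ ()
... | just c with findGap c D (r ∸ 1) in e₂
...   | just r' = yes (fires c r' e₁ e₂)
...   | nothing = no λ where
          (fires _ _ e₁′ e₂′) → case trans (sym e₁) e₁′ of λ where
            refl → case trans (sym e₂) e₂′ of λ ()

¬fires⇒fixed : ∀ r D → ¬ Fires r D → kohnertMove r D ≡ D
¬fires⇒fixed r D ¬f with rowMax r D in e₁
... | nothing = refl
... | just c with findGap c D (r ∸ 1) in e₂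
...   | nothing = refl
...   | just r' = contradiction (fires c r' e₁ e₂) ¬f

fires⇒moved : ∀ {r D} (f : Fires r D) → let open Fires f in
              kohnertMove r D ≡ (gap , col) ∷ removeCell (r , col) D
fires⇒moved (fires c r' e₁ e₂) rewrite e₁ | e₂ = refl

1≤x≤n∸1⇒x<n : ∀ {x n} → 1 ≤ x → x ≤ n ∸ 1 → x < n
1≤x≤n∸1⇒x<n {n = zero} (s≤s _) ()
1≤x≤n∸1⇒x<n {n = suc n} _ x≤n = s≤s x≤n

x<n⇒x≤n∸1 : ∀ {x n} → x < n → x ≤ n ∸ 1
x<n⇒x≤n∸1 (s≤s x≤n) = x≤n

module FiringMove {r D} (f : Fires r D) where
  open Fires f public

  D′ : Diagram
  D′ = (gap , col) ∷ removeCell (r , col) D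

  1≤gap : 1 ≤ gap
  1≤gap = proj₁ (findGap-bounds col D (r ∸ 1) findGap≡gap)

  gap<r : gap < r
  gap<r = 1≤x≤n∸1⇒x<n 1≤gap (proj₂ (findGap-bounds col D (r ∸ 1) findGap≡gap))

  source∈ : (r , col) ∈ D
  source∈ = rowMax-∈ r D rowMax≡col

  gap-free : memb (gap , col) D ≡ false
  gap-free = findGap-free col D (r ∸ 1) findGap≡gap

  between-full : ∀ z → gap < z → z ≤ r → memb (z , col) D ≡ true
  between-full z gap<z z≤r with m≤n⇒m<n∨m≡n z≤r
  ... | inj₂ refl = ∈⇒memb D source∈
  ... | inj₁ z<r = findGap-above col D (r ∸ 1) findGap≡gap z gap<z (x<n⇒x≤n∸1 z<r)

  right-of-source-free : ∀ {c'} → col < c' → memb (r , c') D ≡ false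
  right-of-source-free col<c' = ∉⇒memb D λ rc'∈D → <⇒≱ col<c' (rowMax-maximal r D rowMax≡col rc'∈D)

  gap-full′ : memb (gap , col) D′ ≡ true
  gap-full′ = ∈⇒memb D′ (here refl)

  source-free′ : memb (r , col) D′ ≡ false
  source-free′ = ∉⇒memb D′ λ where
    (here refl) → <-irrefl refl gap<r
    (there p) → proj₂ (∈-removeCell⁻ D p) refl

  unchanged : ∀ x → x ≢ (gap , col) → x ≢ (r , col) → memb x D′ ≡ memb x D
  unchanged x ≢gap ≢source = memb-cong D′ D to (λ x∈D → there (∈-removeCell⁺ D x∈D ≢source))
    where
    to : x ∈ D′ → x ∈ D
    to (here x≡gap) = contradiction x≡gap ≢gap
    to (there p) = proj₁ (∈-removeCell⁻ D p)

  free-stays-free : ∀ x → memb x D ≡ false → x ≢ (gap , col) → memb x D′ ≡ false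
  free-stays-free x free ≢gap = ∉⇒memb D′ λ where
    (here x≡gap) → ≢gap x≡gap
    (there p) → memb⇒∉ D free (proj₁ (∈-removeCell⁻ D p))

-- The row sum and the maximum

rowSum : Diagram → ℕ
rowSum [] = 0
rowSum ((r , c) ∷ D) = r + rowSum D

rowSum-removeCell : ∀ y D → rowSum (removeCell y D) ≤ rowSum D
rowSum-removeCell y [] = ≤-refl
rowSum-removeCell y ((r , c) ∷ D) with cellEq y (r , c)
... | true = ≤-trans (rowSum-removeCell y D) (m≤n+m (rowSum D) r)
... | false = +-monoʳ-≤ r (rowSum-removeCell y D)

rowSum-removeCell-∈ : ∀ {r c} D → (r , c) ∈ D → r + rowSum (removeCell (r , c) D) ≤ rowSum D
rowSum-removeCell-∈ {r} {c} ((r₀ , c₀) ∷ D) y∈ with cellEq (r , c) (r₀ , c₀) in eq | y∈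
... | false | here refl = contradiction refl (cellEq-false⇒≢ (r , c) (r , c) eq)
... | false | there y∈D = begin
  r + (r₀ + rowSum (removeCell (r , c) D)) ≡⟨ x∙yz≈y∙xz r r₀ _ ⟩
  r₀ + (r + rowSum (removeCell (r , c) D)) ≤⟨ +-monoʳ-≤ r₀ (rowSum-removeCell-∈ D y∈D) ⟩
  r₀ + rowSum D                            ∎
  where open ≤-Reasoning
... | true | _ with cellEq⇒≡ (r , c) (r₀ , c₀) eq
...   | refl = +-monoʳ-≤ r (rowSum-removeCell (r , c) D)

rowSum-fires : ∀ {r D} → Fires r D → rowSum (kohnertMove r D) < rowSum D
rowSum-fires {r} {D} f rewrite fires⇒moved f = begin-strict
  gap + rowSum (removeCell (r , col) D) <⟨ +-monoˡ-< _ gap<r ⟩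
  r + rowSum (removeCell (r , col) D) ≤⟨ rowSum-removeCell-∈ D source∈ ⟩
  rowSum D ∎
  where open ≤-Reasoning
        open FiringMove f

Reach-trans : ∀ {D E F} → Reach D E → Reach E F → Reach D F
Reach-trans done q = q
Reach-trans (step r p) q = step r (Reach-trans p q)

Reach⇒rowSum≤ : ∀ {D E} → Reach D E → rowSum E ≤ rowSum D
Reach⇒rowSum≤ done = ≤-refl
Reach⇒rowSum≤ {D} (step r p) with fires? r D
... | yes f = ≤-trans (Reach⇒rowSum≤ p) (<⇒≤ (rowSum-fires f))
... | no ¬f = subst (λ X → _ ≤ rowSum X) (¬fires⇒fixed r D ¬f) (Reach⇒rowSum≤ p)

Reach-rowSum-≥⇒≡ : ∀ {D E} → Reach D E → rowSum D ≤ rowSum E → E ≡ D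
Reach-rowSum-≥⇒≡ done _ = refl
Reach-rowSum-≥⇒≡ {D} (step r p) D≤E with fires? r D
... | yes f = contradiction (≤-trans D≤E (Reach⇒rowSum≤ p)) (<⇒≱ (rowSum-fires f))
... | no ¬f rewrite ¬fires⇒fixed r D ¬f = Reach-rowSum-≥⇒≡ p D≤E

≈D-refl : ∀ {D} → D ≈D D
≈D-refl x = (λ p → p) , (λ p → p)

≈D-sym : ∀ {D E} → D ≈D E → E ≈D D
≈D-sym D≈E x = proj₂ (D≈E x) , proj₁ (D≈E x)

HasUniqueMaximal : Diagram → Set
HasUniqueMaximal D₀ = Σ Diagram λ M → IsMaximal D₀ M × (∀ M' → IsMaximal D₀ M' → M' ≈D M)

unique-maximal : ∀ D₀ → HasUniqueMaximal D₀
unique-maximal D₀ = D₀ , (done , D₀-maximal) , λ M' (D₀→M' , M'-maximal) → ≈D-sym (M'-maximal D₀ done D₀→M')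
  where
  D₀-maximal : ∀ X → Reach D₀ X → Reach X D₀ → X ≈D D₀
  D₀-maximal X D₀→X X→D₀ rewrite Reach-rowSum-≥⇒≡ D₀→X (Reach⇒rowSum≤ X→D₀) = ≈D-refl

downward-induction : ∀ {ℓ} (P : ℕ → Set ℓ) {p} → P p → (∀ {s} → s < p → P (suc s) → P s) →
                     ∀ {s} → s ≤ p → P s
downward-induction P {p} P-top P-step {s} s≤p = go (p ∸ s) s (m+[n∸m]≡n s≤p)
  where
  go : ∀ d s → s + d ≡ p → P s
  go zero s s+0≡p = subst P (trans (sym s+0≡p) (+-identityʳ s)) P-top
  go (suc d) s s+1+d≡p = P-step (subst (s <_) s+1+d≡p (m<m+n s (s≤s z≤n)))
                                (go d (suc s) (trans (sym (+-suc s d)) s+1+d≡p))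

toℕ : Bool → ℕ
toℕ true = 1
toℕ false = 0

toℕ≤1 : ∀ b → toℕ b ≤ 1
toℕ≤1 true = ≤-refl
toℕ≤1 false = z≤n

toℕ-mono : ∀ {a b} → (a ≡ true → b ≡ true) → toℕ a ≤ toℕ b
toℕ-mono {false} _ = z≤n
toℕ-mono {true} a⇒b rewrite a⇒b refl = ≤-refl

count : (ℕ → Bool) → ℕ → ℕ → ℕ
count f s zero = 0
count f s (suc n) = toℕ (f s) + count f (suc s) n

count-snoc : ∀ f s n → count f s (suc n) ≡ count f s n + toℕ (f (s + n))
count-snoc f s zero rewrite +-identityʳ s = +-comm (toℕ (f s)) 0
count-snoc f s (suc n) rewrite count-snoc f (suc s) n | +-suc s n =
  sym (+-assoc (toℕ (f s)) (count f (suc s) n) _)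

count-cong : ∀ f g s n → (∀ z → s ≤ z → f z ≡ g z) → count f s n ≡ count g s n
count-cong f g s zero f≗g = refl
count-cong f g s (suc n) f≗g =
  cong₂ _+_ (cong toℕ (f≗g s ≤-refl)) (count-cong f g (suc s) n (λ z s<z → f≗g z (<⇒≤ s<z)))

count-mono : ∀ f g s n → (∀ z → f z ≡ true → g z ≡ true) → count f s n ≤ count g s n
count-mono f g s zero f⇒g = z≤n
count-mono f g s (suc n) f⇒g = +-mono-≤ (toℕ-mono (f⇒g s)) (count-mono f g (suc s) n f⇒g)

count≤ : ∀ f s n → count f s n ≤ n
count≤ f s zero = z≤n
count≤ f s (suc n) = +-mono-≤ (toℕ≤1 (f s)) (count≤ f (suc s) n)

count-all : ∀ f s n → (∀ z → s ≤ z → z < s + n → f z ≡ true) → count f s n ≡ n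
count-all f s zero all = refl
count-all f s (suc n) all rewrite all s ≤-refl (m<m+n s (s≤s z≤n)) =
  cong suc (count-all f (suc s) n λ z s<z z<1+s+n → all z (<⇒≤ s<z) (subst (z <_) (sym (+-suc s n)) z<1+s+n))

count-none : ∀ f s n → (∀ z → s ≤ z → f z ≡ false) → count f s n ≡ 0
count-none f s zero none = refl
count-none f s (suc n) none rewrite none s ≤-refl = count-none f (suc s) n λ z s<z → none z (<⇒≤ s<z)

count-full : ∀ f s n → n ≤ count f s n → ∀ z → s ≤ z → z < s + n → f z ≡ true
count-full f s zero _ z s≤z z<s+0 = contradiction (subst (z <_) (+-identityʳ s) z<s+0) (≤⇒≯ s≤z)
count-full f s (suc n) n≤count z s≤z z<s+1+n with f s in fs
... | false = contradiction n≤count (<⇒≱ (s≤s (count≤ f (suc s) n)))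
... | true with m≤n⇒m<n∨m≡n s≤z
...   | inj₂ refl = fs
...   | inj₁ s<z = count-full f (suc s) n (s≤s⁻¹ n≤count) z s<z (subst (z <_) (+-suc s n) z<s+1+n)

VanishesFrom : ℕ → (ℕ → Bool) → Set
VanishesFrom K f = ∀ z → K ≤ z → f z ≡ false

-- For f vanishing from K this counts all z ≥ s with f z.
countAbove : ℕ → (ℕ → Bool) → ℕ → ℕ
countAbove K f s = count f s K

vanishes-above : ∀ {K f} t → VanishesFrom K f → (∀ z → t < z → z < K → f z ≡ false) → ∀ z → t < z → f z ≡ false
vanishes-above {K} t vanish empty-below-K z t<z with z <? K
... | yes z<K = empty-below-K z t<z z<K
... | no z≮K = vanish z (≮⇒≥ z≮K)

countAbove-step : ∀ {K f} → VanishesFrom K f → ∀ s → countAbove K f s ≡ toℕ (f s) + countAbove K f (suc s)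
countAbove-step {K} {f} vanish s = begin
  count f s K                       ≡⟨ sym (+-identityʳ _) ⟩
  count f s K + 0                   ≡⟨ cong (λ b → count f s K + toℕ b) (sym (vanish (s + K) (m≤n+m K s))) ⟩
  count f s K + toℕ (f (s + K))     ≡⟨ sym (count-snoc f s K) ⟩
  toℕ (f s) + count f (suc s) K     ∎
  where open ≡-Reasoning

countAbove-split : ∀ {K f} → VanishesFrom K f → ∀ s n → countAbove K f s ≡ count f s n + countAbove K f (s + n)
countAbove-split vanish s zero rewrite +-identityʳ s = refl
countAbove-split {K} {f} vanish s (suc n)
  rewrite countAbove-step vanish s | countAbove-split vanish (suc s) n | +-suc s n =
  sym (+-assoc (toℕ (f s)) (count f (suc s) n) _)

countAbove-cong : ∀ K f g s → (∀ z → s ≤ z → f z ≡ g z) → countAbove K f s ≡ countAbove K g s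
countAbove-cong K f g s = count-cong f g s K

module LowerOne {K} {f g : ℕ → Bool} (f-vanish : VanishesFrom K f) (g-vanish : VanishesFrom K g)
  {q p} (q<p : q < p) (fp : f p ≡ true) (gp : g p ≡ false) (fq : f q ≡ false) (gq : g q ≡ true)
  (f-between : ∀ z → q < z → z < p → f z ≡ true)
  (g≗f : ∀ z → z ≢ p → z ≢ q → g z ≡ f z) where

  private
    N : (ℕ → Bool) → ℕ → ℕ
    N = countAbove K

  above-source : ∀ {s} → p < s → N g s ≡ N f s
  above-source p<s = countAbove-cong K g f _ λ z s≤z →
    g≗f z (<⇒≢ (<-≤-trans p<s s≤z) ∘ sym) (<⇒≢ (<-≤-trans (<-trans q<p p<s) s≤z) ∘ sym)

  between : ∀ {s} → s ≤ p → q < s → suc (N g s) ≡ N f s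
  between = downward-induction (λ s → q < s → suc (N g s) ≡ N f s) top next
    where
    top : q < p → suc (N g p) ≡ N f p
    top _ rewrite countAbove-step g-vanish p | countAbove-step f-vanish p | gp | fp =
      cong suc (above-source ≤-refl)
    next : ∀ {s} → s < p → (q < suc s → suc (N g (suc s)) ≡ N f (suc s)) → q < s → suc (N g s) ≡ N f s
    next {s} s<p ih q<s
      rewrite countAbove-step g-vanish s | countAbove-step f-vanish s
            | g≗f s (<⇒≢ s<p) (<⇒≢ q<s ∘ sym) | f-between s q<s s<p =
      cong suc (ih (m<n⇒m<1+n q<s))

  up-to-target : ∀ {s} → s ≤ q → N g s ≡ N f s
  up-to-target = downward-induction (λ s → N g s ≡ N f s) top next
    where
    top : N g q ≡ N f q
    top rewrite countAbove-step g-vanish q | countAbove-step f-vanish q | gq | fq = between q<p ≤-refl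
    next : ∀ {s} → s < q → N g (suc s) ≡ N f (suc s) → N g s ≡ N f s
    next {s} s<q ih rewrite countAbove-step g-vanish s | countAbove-step f-vanish s
                          | g≗f s (<⇒≢ (<-trans s<q q<p)) (<⇒≢ s<q) = cong (toℕ (f s) +_) ih

  countAbove-≤ : ∀ s → N g s ≤ N f s
  countAbove-≤ s with ≤-<-connex s q
  ... | inj₁ s≤q = ≤-reflexive (up-to-target s≤q)
  ... | inj₂ q<s with ≤-<-connex s p
  ...   | inj₁ s≤p = ≤-trans (n≤1+n _) (≤-reflexive (between s≤p q<s))
  ...   | inj₂ p<s = ≤-reflexive (above-source p<s)

countAbove-strict : ∀ {K f h} → VanishesFrom K f → VanishesFrom K h → ∀ {q p} →
  h p ≡ false → (∀ z → q < z → z ≤ p → f z ≡ true) →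
  countAbove K h (suc p) ≤ countAbove K f (suc p) →
  ∀ {s} → s ≤ p → q < s → countAbove K h s < countAbove K f s
countAbove-strict {K} {f} {h} f-vanish h-vanish {q} {p} hp f-full above =
  downward-induction (λ s → q < s → countAbove K h s < countAbove K f s) top next
  where
  top : q < p → countAbove K h p < countAbove K f p
  top q<p rewrite countAbove-step h-vanish p | countAbove-step f-vanish p | hp | f-full p q<p ≤-refl =
    s≤s above
  next : ∀ {s} → s < p → (q < suc s → countAbove K h (suc s) < countAbove K f (suc s)) →
         q < s → countAbove K h s < countAbove K f s
  next {s} s<p ih q<s rewrite countAbove-step h-vanish s | countAbove-step f-vanish s | f-full s q<s (<⇒≤ s<p) =
    s≤s (≤-trans (+-monoˡ-≤ _ (toℕ≤1 (h s))) (ih (m<n⇒m<1+n q<s)))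

-- The dominance invariant

column : Diagram → ℕ → ℕ → Bool
column D c x = memb (x , c) D

record Invariant (K : ℕ) (T : ℕ → ℕ) (D : Diagram) : Set where
  field
    row0-empty : ∀ c → column D c 0 ≡ false
    column0-empty : ∀ x → column D 0 x ≡ false
    vanishes : ∀ c → VanishesFrom K (column D c)
    size : ∀ c → countAbove K (column D c) 1 ≡ T c
    dominance : ∀ {c c'} → 1 ≤ c → c < c' → ∀ s → countAbove K (column D c') s ≤ countAbove K (column D c) s

fires⇒row<K : ∀ {K T r D} → Invariant K T D → Fires r D → r < K
fires⇒row<K {K} {r = r} {D} inv f with r <? K
... | yes r<K = r<K
... | no r≮K = contradiction (trans (sym (∈⇒memb D source∈)) (vanishes col r (≮⇒≥ r≮K))) λ ()
  where open Invariant inv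
        open FiringMove f

module AfterFiring {K T r D} (inv : Invariant K T D) (f : Fires r D) where
  open Invariant inv
  open FiringMove f public

  col≢0 : col ≢ 0
  col≢0 refl = contradiction (trans (sym (∈⇒memb D source∈)) (column0-empty r)) λ ()

  vanishes′ : ∀ c → VanishesFrom K (column D′ c)
  vanishes′ c x K≤x = free-stays-free (x , c) (vanishes c x K≤x) (<⇒≢ (<-≤-trans (<-trans gap<r (fires⇒row<K inv f)) K≤x) ∘ sym ∘ cong proj₁)

  other-column : ∀ {c} → c ≢ col → ∀ s → countAbove K (column D′ c) s ≡ countAbove K (column D c) s
  other-column c≢col s = countAbove-cong K _ _ s λ x _ →
    unchanged (x , _) (c≢col ∘ cong proj₂) (c≢col ∘ cong proj₂)

  module Lowered = LowerOne (vanishes col) (vanishes′ col) gap<r (∈⇒memb D source∈) source-free′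
    gap-free gap-full′ (λ z gap<z z<r → between-full z gap<z (<⇒≤ z<r))
    (λ z z≢r z≢gap → unchanged (z , col) (z≢gap ∘ cong proj₁) (z≢r ∘ cong proj₁))

  size′ : ∀ c → countAbove K (column D′ c) 1 ≡ T c
  size′ c with c ≟ col
  ... | yes refl = trans (Lowered.up-to-target 1≤gap) (size col)
  ... | no c≢col = trans (other-column c≢col 1) (size c)

  -- Between the gap and row r, column col loses one cell, but it had strictly more cells there
  -- than column c', because a move takes the rightmost cell of its row.
  moved-dominates : ∀ {c'} → 1 ≤ col → col < c' → c' ≢ col → ∀ s →
                    countAbove K (column D′ c') s ≤ countAbove K (column D′ col) s
  moved-dominates {c'} 1≤col col<c' c'≢col s rewrite other-column c'≢col s with ≤-<-connex s gap
  ... | inj₁ s≤gap = ≤-trans (dominance 1≤col col<c' s) (≤-reflexive (sym (Lowered.up-to-target s≤gap)))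
  ... | inj₂ gap<s with ≤-<-connex s r
  ...   | inj₂ r<s = ≤-trans (dominance 1≤col col<c' s) (≤-reflexive (sym (Lowered.above-source r<s)))
  ...   | inj₁ s≤r = s≤s⁻¹ (≤-trans
          (countAbove-strict (vanishes col) (vanishes c') (right-of-source-free col<c') between-full
            (dominance 1≤col col<c' (suc r)) s≤r gap<s)
          (≤-reflexive (sym (Lowered.between s≤r gap<s))))

  dominance′ : ∀ {c c'} → 1 ≤ c → c < c' → ∀ s → countAbove K (column D′ c') s ≤ countAbove K (column D′ c) s
  dominance′ {c} {c'} 1≤c c<c' s with c ≟ col | c' ≟ col
  ... | yes refl | yes refl = contradiction c<c' (<-irrefl refl)
  ... | yes refl | no c'≢col = moved-dominates 1≤c c<c' c'≢col s
  ... | no c≢col | yes refl = begin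
    countAbove K (column D′ col) s ≤⟨ Lowered.countAbove-≤ s ⟩
    countAbove K (column D col) s  ≤⟨ dominance 1≤c c<c' s ⟩
    countAbove K (column D c) s    ≡⟨ other-column c≢col s ⟨
    countAbove K (column D′ c) s   ∎
    where open ≤-Reasoning
  ... | no c≢col | no c'≢col = begin
    countAbove K (column D′ c') s ≡⟨ other-column c'≢col s ⟩
    countAbove K (column D c') s  ≤⟨ dominance 1≤c c<c' s ⟩
    countAbove K (column D c) s   ≡⟨ other-column c≢col s ⟨
    countAbove K (column D′ c) s  ∎
    where open ≤-Reasoning

Invariant-fires : ∀ {K T r D} → Invariant K T D → (f : Fires r D) → Invariant K T (kohnertMove r D)
Invariant-fires {K} {T} inv f = subst (Invariant K T) (sym (fires⇒moved f)) (record
  { row0-empty = λ c → free-stays-free (0 , c) (row0-empty c) (<⇒≢ 1≤gap ∘ cong proj₁)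
  ; column0-empty = λ x → free-stays-free (x , 0) (column0-empty x) (col≢0 ∘ sym ∘ cong proj₂)
  ; vanishes = vanishes′
  ; size = size′
  ; dominance = dominance′
  })
  where
  open Invariant inv
  open AfterFiring inv f

Invariant-Reach : ∀ {K T D E} → Invariant K T D → Reach D E → Invariant K T E
Invariant-Reach inv done = inv
Invariant-Reach {D = D} inv (step r p) with fires? r D
... | yes f = Invariant-Reach (Invariant-fires inv f) p
... | no ¬f = Invariant-Reach (subst (Invariant _ _) (sym (¬fires⇒fixed r D ¬f)) inv) p

-- Stuck diagrams and the minimum

highest-true : ∀ (f : ℕ → Bool) n →
  (∃ λ t → t < n × f t ≡ true × ∀ z → t < z → z < n → f z ≡ false) ⊎ (∀ z → z < n → f z ≡ false)
highest-true f zero = inj₂ λ _ ()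
highest-true f (suc n) with f n in fn | highest-true f n
... | true | _ = inj₁ (n , ≤-refl , fn , λ z n<z z<1+n → contradiction (s≤s⁻¹ z<1+n) (<⇒≱ n<z))
... | false | inj₁ (t , t<n , ft , above) = inj₁ (t , m<n⇒m<1+n t<n , ft , above′)
  where
  above′ : ∀ z → t < z → z < suc n → f z ≡ false
  above′ z t<z z<1+n with m<1+n⇒m<n∨m≡n z<1+n
  ... | inj₁ z<n = above z t<z z<n
  ... | inj₂ refl = fn
... | false | inj₂ none = inj₂ none′
  where
  none′ : ∀ z → z < suc n → f z ≡ false
  none′ z z<1+n with m<1+n⇒m<n∨m≡n z<1+n
  ... | inj₁ z<n = none z z<n
  ... | inj₂ refl = fn

IsSegment : (ℕ → Bool) → ℕ → Set
IsSegment f t = ∀ y → (f y ≡ true → 1 ≤ y × y ≤ t) × (1 ≤ y → y ≤ t → f y ≡ true)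

segment-size : ∀ {K f t} → VanishesFrom K f → IsSegment f t → countAbove K f 1 ≡ t
segment-size {K} {f} {t} vanish segment = begin
  countAbove K f 1                      ≡⟨ countAbove-split vanish 1 t ⟩
  count f 1 t + countAbove K f (suc t)  ≡⟨ cong₂ _+_ (count-all f 1 t λ z 1≤z z<1+t → proj₂ (segment z) 1≤z (s≤s⁻¹ z<1+t))
                                                     (count-none f (suc t) K λ z t<z → empty-above z t<z) ⟩
  t + 0                                 ≡⟨ +-identityʳ t ⟩
  t                                     ∎
  where
  open ≡-Reasoning
  empty-above : ∀ z → t < z → f z ≡ false
  empty-above z t<z with f z in fz
  ... | false = refl
  ... | true = contradiction (proj₂ (proj₁ (segment z) fz)) (<⇒≱ t<z)

Stuck : Diagram → Set
Stuck D = ∀ r → ¬ Fires r D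

Stuck-Reach⇒≡ : ∀ {D E} → Stuck D → Reach D E → E ≡ D
Stuck-Reach⇒≡ stuck done = refl
Stuck-Reach⇒≡ {D} stuck (step r p) rewrite ¬fires⇒fixed r D (stuck r) = Stuck-Reach⇒≡ stuck p

Stuck⇒full-below-rowMax : ∀ {D x c} → Stuck D → rowMax x D ≡ just c →
                           ∀ y → 1 ≤ y → y ≤ x → column D c y ≡ true
Stuck⇒full-below-rowMax {D} {x} {c} stuck rowMax≡c y 1≤y y≤x with findGap c D (x ∸ 1) in noGap
... | just r' = contradiction (fires c r' rowMax≡c noGap) (stuck x)
... | nothing with m≤n⇒m<n∨m≡n y≤x
...   | inj₁ y<x = findGap-nothing c D (x ∸ 1) noGap y 1≤y (x<n⇒x≤n∸1 y<x)
...   | inj₂ refl = ∈⇒memb D (rowMax-∈ y D rowMax≡c)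

module StuckColumns {K T D} (inv : Invariant K T D) (stuck : Stuck D) where
  open Invariant inv

  occupied⇒1≤row : ∀ {c y} → column D c y ≡ true → 1 ≤ y
  occupied⇒1≤row {c} {zero} occ = contradiction (trans (sym occ) (row0-empty c)) λ ()
  occupied⇒1≤row {c} {suc y} _ = s≤s z≤n

  occupied⇒1≤column : ∀ {c y} → column D c y ≡ true → 1 ≤ c
  occupied⇒1≤column {zero} {y} occ = contradiction (trans (sym occ) (column0-empty y)) λ ()
  occupied⇒1≤column {suc c} _ = s≤s z≤n

  -- The last cell of row t lies in a column filled from row 1 to row t, as D is stuck;
  -- dominance gives column c at least t cells, and all of them lie in rows 1, …, t.
  full-below-top : ∀ {c t} → column D c t ≡ true → (∀ z → t < z → column D c z ≡ false) →
                   ∀ y → 1 ≤ y → y ≤ t → column D c y ≡ true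
  full-below-top {c} {t} occ empty-above y 1≤y y≤t
    with ∈⇒rowMax-just t D (memb⇒∈ D occ)
  ... | c₂ , rowMax≡c₂ with m≤n⇒m<n∨m≡n (rowMax-maximal t D rowMax≡c₂ (memb⇒∈ D occ))
  ...   | inj₂ refl = Stuck⇒full-below-rowMax stuck rowMax≡c₂ y 1≤y y≤t
  ...   | inj₁ c<c₂ = count-full (column D c) 1 t t≤count y 1≤y (s≤s y≤t)
    where
    open ≤-Reasoning
    t≤count : t ≤ count (column D c) 1 t
    t≤count = begin
      t                                                             ≡⟨ count-all (column D c₂) 1 t (λ z 1≤z z<1+t →
                                                                         Stuck⇒full-below-rowMax stuck rowMax≡c₂ z 1≤z (s≤s⁻¹ z<1+t)) ⟨
      count (column D c₂) 1 t                                       ≤⟨ m≤m+n _ _ ⟩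
      count (column D c₂) 1 t + countAbove K (column D c₂) (suc t)  ≡⟨ countAbove-split (vanishes c₂) 1 t ⟨
      countAbove K (column D c₂) 1                                  ≤⟨ dominance (occupied⇒1≤column occ) c<c₂ 1 ⟩
      countAbove K (column D c) 1                                   ≡⟨ countAbove-split (vanishes c) 1 t ⟩
      count (column D c) 1 t + countAbove K (column D c) (suc t)    ≡⟨ cong (_ +_) (count-none (column D c) (suc t) K empty-above) ⟩
      count (column D c) 1 t + 0                                    ≡⟨ +-identityʳ _ ⟩
      count (column D c) 1 t                                        ∎

  segment : ∀ {c t} → (∀ y → 1 ≤ y → y ≤ t → column D c y ≡ true) →
            (∀ z → t < z → column D c z ≡ false) → IsSegment (column D c) t
  segment {c} {t} full empty y = occupied⇒≤t , full y
    where
    occupied⇒≤t : column D c y ≡ true → 1 ≤ y × y ≤ t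
    occupied⇒≤t occ with y ≤? t
    ... | yes y≤t = occupied⇒1≤row occ , y≤t
    ... | no y≰t = contradiction (trans (sym occ) (empty y (≰⇒> y≰t))) λ ()

  column-segment : ∀ c → ∃ λ t → IsSegment (column D c) t
  column-segment c with highest-true (column D c) K
  ... | inj₁ (t , _ , occ , empty-below-K) =
    t , segment (full-below-top occ empty-above) empty-above
    where
    empty-above : ∀ z → t < z → column D c z ≡ false
    empty-above = vanishes-above t (vanishes c) empty-below-K
  ... | inj₂ empty-below-K =
    0 , segment (λ y 1≤y y≤0 → contradiction y≤0 (<⇒≱ 1≤y)) (vanishes-above 0 (vanishes c) λ z _ → empty-below-K z)

  column-is-segment : ∀ c → IsSegment (column D c) (T c)
  column-is-segment c with column-segment c
  ... | t , segment = subst (IsSegment (column D c)) (trans (sym (segment-size (vanishes c) segment)) (size c)) segment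

Stuck-unique : ∀ {K T D E} → Invariant K T D → Stuck D → Invariant K T E → Stuck E → D ≈D E
Stuck-unique {D = D} {E} invD stuckD invE stuckE (x , c) = transfer D E shapeD shapeE , transfer E D shapeE shapeD
  where
  shapeD : IsSegment (column D c) _
  shapeD = StuckColumns.column-is-segment invD stuckD c
  shapeE : IsSegment (column E c) _
  shapeE = StuckColumns.column-is-segment invE stuckE c
  transfer : ∀ A B {t} → IsSegment (column A c) t → IsSegment (column B c) t → (x , c) ∈ A → (x , c) ∈ B
  transfer A B segA segB x∈A = let (1≤x , x≤t) = proj₁ (segA x) (∈⇒memb A x∈A) in memb⇒∈ B (proj₂ (segB x) 1≤x x≤t)

reach-Stuck : ∀ {K T D} → Invariant K T D → ∃ λ m → Reach D m × Stuck m
reach-Stuck {K} {T} {D} inv = descend (suc (rowSum D)) ≤-refl inv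
  where
  descend : ∀ n {D} → rowSum D < n → Invariant K T D → ∃ λ m → Reach D m × Stuck m
  descend (suc n) {D} rowSum<1+n inv with anyUpTo? (λ r → fires? r D) K
  ... | yes (r , _ , f) =
    let (m , D′→m , stuck) = descend n (≤-trans (rowSum-fires f) (s≤s⁻¹ rowSum<1+n)) (Invariant-fires inv f)
    in m , step r D′→m , stuck
  ... | no none-fires = D , done , λ r f → none-fires (r , fires⇒row<K inv f , f)

IsMinimal⇒Stuck : ∀ {D₀ m} → IsMinimal D₀ m → Stuck m
IsMinimal⇒Stuck {m = m} (D₀→m , minimal) r f = memb⇒∉ m gap-free (proj₁ (moved≈m (gap , col)) gap∈moved)
  where
  open FiringMove f
  moved≈m : kohnertMove r m ≈D m
  moved≈m = minimal _ (Reach-trans D₀→m (step r done)) (step r done)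
  gap∈moved : (gap , col) ∈ kohnertMove r m
  gap∈moved rewrite fires⇒moved f = here refl

HasUniqueMinimal : Diagram → Set
HasUniqueMinimal D₀ = Σ Diagram λ m → IsMinimal D₀ m × (∀ m' → IsMinimal D₀ m' → m' ≈D m)

unique-minimal : ∀ {K T D₀} → Invariant K T D₀ → HasUniqueMinimal D₀
unique-minimal {D₀ = D₀} inv₀ with reach-Stuck inv₀
... | m , D₀→m , stuck = m , (D₀→m , m-minimal) , λ m' m'-minimal →
  Stuck-unique (Invariant-Reach inv₀ (proj₁ m'-minimal)) (IsMinimal⇒Stuck m'-minimal) (Invariant-Reach inv₀ D₀→m) stuck
  where
  m-minimal : ∀ x → Reach D₀ x → Reach m x → x ≈D m
  m-minimal x _ m→x rewrite Stuck-Reach⇒≡ stuck m→x = ≈D-refl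

keyRow : ℕ → ℕ → Diagram
keyRow i aᵢ = map (λ j → (i , suc j)) (upTo aᵢ)

∈-keyRows⁻ : ∀ i a {x c} → (x , c) ∈ keyRows i a → i ≤ x × x < i + length a × 1 ≤ c
∈-keyRows⁻ i (aᵢ ∷ a) {x} x∈ with ∈-++⁻ (keyRow i aᵢ) x∈
... | inj₁ x∈row with ∈-map⁻ (λ j → (i , suc j)) x∈row
...   | _ , _ , refl = ≤-refl , subst (i <_) (sym (+-suc i (length a))) (s≤s (m≤m+n i (length a))) , s≤s z≤n
∈-keyRows⁻ i (aᵢ ∷ a) {x} x∈ | inj₂ x∈rest =
  let (1+i≤x , x<1+i+a , 1≤c) = ∈-keyRows⁻ (suc i) a x∈rest
  in <⇒≤ 1+i≤x , subst (x <_) (sym (+-suc i (length a))) x<1+i+a , 1≤c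

keyRows-left-closed : ∀ i a {x c c'} → (x , c) ∈ keyRows i a → 1 ≤ c' → c' ≤ c → (x , c') ∈ keyRows i a
keyRows-left-closed i (aᵢ ∷ a) {c' = suc c'} x∈ 1≤c' c'≤c with ∈-++⁻ (keyRow i aᵢ) x∈
... | inj₂ x∈rest = ∈-++⁺ʳ (keyRow i aᵢ) (keyRows-left-closed (suc i) a x∈rest 1≤c' c'≤c)
... | inj₁ x∈row with ∈-map⁻ (λ j → (i , suc j)) x∈row
...   | _ , j∈ , refl = ∈-++⁺ˡ (∈-map⁺ (λ j → (i , suc j)) (∈-upTo⁺ (≤-<-trans (s≤s⁻¹ c'≤c) (∈-upTo⁻ j∈))))

keyDiagram-Invariant : ∀ a → let D₀ = keyDiagram a; K = suc (length a) in
                       Invariant K (λ c → countAbove K (column D₀ c) 1) D₀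
keyDiagram-Invariant a = record
  { row0-empty = λ c → ∉⇒memb D₀ λ x∈ → contradiction (proj₁ (∈-keyRows⁻ 1 a x∈)) λ ()
  ; column0-empty = λ x → ∉⇒memb D₀ λ x∈ → contradiction (proj₂ (proj₂ (∈-keyRows⁻ 1 a x∈))) λ ()
  ; vanishes = λ c x K≤x → ∉⇒memb D₀ λ x∈ → <⇒≱ (proj₁ (proj₂ (∈-keyRows⁻ 1 a x∈))) K≤x
  ; size = λ c → refl
  ; dominance = λ {c} {c'} 1≤c c<c' s → count-mono (column D₀ c') (column D₀ c) s (suc (length a)) λ z occ →
      ∈⇒memb D₀ (keyRows-left-closed 1 a (memb⇒∈ D₀ occ) 1≤c (<⇒≤ c<c'))
  }
  where D₀ = keyDiagram a

theorem6p1 : (a : List ℕ) → Bounded (keyDiagram a)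
theorem6p1 a = unique-minimal (keyDiagram-Invariant a) , unique-maximal (keyDiagram a)
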